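{- For a graph $H$, the property $\Pi_H$ is nontrivial if and only if $H$ has at least two vertices.
   Context: All graphs are finite and simple. For a graph $G$ and $S\subseteq V(G)$, $G\oplus S$ is the graph obtained from $G$ by complementing the subgraph induced by $S$ (a pair $u,v$ has its adjacency flipped iff both $u,v\in S$). A graph $G$ has property $\Pi_H$ if there exists $S\subseteq V(G)$ such that $G\oplus S$ has no induced subgraph isomorphic to $H$. A graph property is nontrivial if it is true for infinitely many graphs and false for infinitely many graphs (graphs considered up to isomorphism), and trivial otherwise. -}

module Defs where

open import Data.Bool using (Bool; true; false; not; _∧_; _xor_)
open import Data.Nat using (ℕ)
open import Data.Fin using (Fin)
open import Data.Fin.Properties using () renaming (_≟_ to _≟F_)
open import Data.List using (List)
open import Data.List.Relation.Unary.All using (All)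
open import Data.Product using (Σ; ∃; _×_; _,_)
open import Function.Bundles using (_↔_; Inverse)
open import Function.Definitions using (Injective)
open import Relation.Nullary using (¬_; does)
open import Relation.Binary.PropositionalEquality using (_≡_; refl; sym; trans)

record Graph : Set where
  field
    n     : ℕ
    adj   : Fin n → Fin n → Bool
    adj-sym : ∀ u v → adj u v ≡ adj v u
    adj-irr : ∀ u → adj u u ≡ false
open Graph public

_≅_ : Graph → Graph → Set
G ≅ G' = Σ (Fin (n G) ↔ Fin (n G')) λ f →
  ∀ u v → adj G u v ≡ adj G' (Inverse.to f u) (Inverse.to f v)

HasInduced : Graph → Graph → Set
HasInduced G H = Σ (Fin (n H) → Fin (n G)) λ ι →
  Injective _≡_ _≡_ ι × (∀ u v → adj H u v ≡ adj G (ι u) (ι v))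

private
  flipS : ∀ {m} → (Fin m → Bool) → Fin m → Fin m → Bool
  flipS S u v = S u ∧ S v ∧ not (does (u ≟F v))

  ∧-comm : ∀ a b → a ∧ b ≡ b ∧ a
  ∧-comm false false = refl
  ∧-comm false true = refl
  ∧-comm true false = refl
  ∧-comm true true = refl

  ≟-sym : ∀ {m} (u v : Fin m) → does (u ≟F v) ≡ does (v ≟F u)
  ≟-sym u v with u ≟F v | v ≟F u
  ... | Relation.Nullary.yes _ | Relation.Nullary.yes _ = refl
  ... | Relation.Nullary.no _  | Relation.Nullary.no _  = refl
  ... | Relation.Nullary.yes p | Relation.Nullary.no q = Data.Empty.⊥-elim (q (sym p))
    where import Data.Empty
  ... | Relation.Nullary.no p  | Relation.Nullary.yes q = Data.Empty.⊥-elim (p (sym q))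
    where import Data.Empty

  flipS-sym : ∀ {m} (S : Fin m → Bool) u v → flipS S u v ≡ flipS S v u
  flipS-sym S u v with S u | S v
  ... | false | false = refl
  ... | false | true  = refl
  ... | true  | false = refl
  ... | true  | true  rewrite ≟-sym u v = refl

  ≟-refl : ∀ {m} (u : Fin m) → does (u ≟F u) ≡ true
  ≟-refl u with u ≟F u
  ... | Relation.Nullary.yes _ = refl
  ... | Relation.Nullary.no p = Data.Empty.⊥-elim (p refl)
    where import Data.Empty

  flipS-irr : ∀ {m} (S : Fin m → Bool) u → flipS S u u ≡ false
  flipS-irr S u rewrite ≟-refl u with S u
  ... | false = refl
  ... | true = refl

  xor-false : ∀ a → a xor false ≡ a
  xor-false false = refl
  xor-false true = refl

_⊕_ : (G : Graph) → (Fin (n G) → Bool) → Graph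
G ⊕ S = record
  { n   = n G
  ; adj = λ u v → adj G u v xor flipS S u v
  ; adj-sym = λ u v → trans (Relation.Binary.PropositionalEquality.cong₂ _xor_ (adj-sym G u v) (flipS-sym S u v)) refl
  ; adj-irr = λ u → trans (Relation.Binary.PropositionalEquality.cong₂ _xor_ (adj-irr G u) (flipS-irr S u)) refl
  }

Π : Graph → Graph → Set
Π H G = Σ (Fin (n G) → Bool) λ S → ¬ HasInduced (G ⊕ S) H

-- P holds for infinitely many graphs up to isomorphism: for every finite
-- list of graphs there is a graph satisfying P isomorphic to none of them.
InfinitelyMany : (Graph → Set) → Set
InfinitelyMany P = (L : List Graph) → ∃ λ G → P G × All (λ G' → ¬ (G' ≅ G)) L

Nontrivial : (Graph → Set) → Set
Nontrivial P = InfinitelyMany P × InfinitelyMany (λ G → ¬ P G)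

-- If H has two vertices u ≠ v, a graph that is complete or edgeless (whichever
-- disagrees with the pair u, v) has no induced H at all, so Π_H holds for
-- graphs of every size. Conversely, take n(H) copies of the complement of H,
-- indexed by the vertices of H, and join copies x ≠ x′ completely exactly when
-- x ~ x′ in H. For any S, either some copy lies inside S, and switching it
-- turns it back into H, or every copy has a vertex outside S, and picking one
-- per copy gives an induced H untouched by the switch. Padding this graph with
-- isolated vertices gives arbitrarily large graphs without Π_H. If H has at
-- most one vertex, every nonempty graph contains H, so only the empty graph
-- has Π_H.
module Submission where

open import Defs
open import Data.Nat using (_≤_)
open import Function.Bundles using (_⇔_)

open import Data.Bool using (Bool; true; false; not; _∧_; if_then_else_)
  renaming (_≟_ to _≟B_)
open import Data.Bool.Properties
  using (xor-identityʳ; xor-comm; not-involutive; not-¬; ¬-not)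
open import Data.Empty using (⊥-elim)
open import Data.Fin using (Fin; zero; suc; _↑ˡ_; splitAt; combine; remQuot)
open import Data.Fin.Properties
  using (any?; all?; ¬∀⟶∃¬; injective⇒≤; splitAt-↑ˡ; remQuot-combine)
  renaming (_≟_ to _≟F_)
open import Data.List using ([]; _∷_; map)
open import Data.List.Extrema.Nat using (max; xs≤max)
import Data.List.Relation.Unary.All as All
open import Data.List.Relation.Unary.All using ([]; _∷_)
open import Data.List.Relation.Unary.All.Properties using (map⁻)
open import Data.Maybe using (Maybe; just; nothing)
open import Data.Maybe.Properties using (just-injective)
open import Data.Nat as ℕ using (ℕ; suc; _*_; _+_; _<_; s≤s)
open import Data.Nat.Properties using (≮⇒≥; <⇒≱; ≤-<-trans; ≤-refl; m≤n+m)
open import Data.Product using (∃; ∃₂; _×_; _,_; proj₁; proj₂)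
open import Data.Sum using (_⊎_; inj₁; inj₂; [_,_]′)
open import Data.Unit using (tt)
open import Function using (_∘_; const)
open import Function.Bundles using (Injection; mk⇔; mk↔ₛ′)
open import Function.Definitions using (Injective)
open import Function.Properties.Inverse using (↔-sym; ↔⇒↣)
open import Relation.Nullary using (¬_; does; yes; no)
open import Relation.Nullary.Decidable using (dec-true; dec-false)
open import Relation.Binary.PropositionalEquality
  using (_≡_; _≢_; refl; sym; trans; cong; cong₂; module ≡-Reasoning)

open ≡-Reasoning

does-≟-sym : ∀ {m} (u v : Fin m) → does (u ≟F v) ≡ does (v ≟F u)
does-≟-sym u v with u ≟F v
... | yes refl = sym (dec-true (u ≟F u) refl)
... | no u≢v   = sym (dec-false (v ≟F u) (u≢v ∘ sym))

distinct-of-2≤ : ∀ {m} → 2 ≤ m → ∃₂ λ (u v : Fin m) → u ≢ v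
distinct-of-2≤ (s≤s (s≤s _)) = zero , suc zero , λ ()

Fin-subsingleton : ∀ {m} → m < 2 → (u v : Fin m) → u ≡ v
Fin-subsingleton {suc ℕ.zero}  _               zero zero = refl
Fin-subsingleton {suc (suc _)} (s≤s (s≤s ())) _    _

∀∃false⊎∃∀true : ∀ {a b} (T : Fin a → Fin b → Bool) →
                 (∀ x → ∃ λ y → T x y ≡ false) ⊎ (∃ λ x → ∀ y → T x y ≡ true)
∀∃false⊎∃∀true {a} T with all? (λ x → any? (λ y → T x y ≟B false))
... | yes hits = inj₁ hits
... | no ¬hits with ¬∀⟶∃¬ a _ (λ x → any? (λ y → T x y ≟B false)) ¬hits
...   | x , ¬hit = inj₂ (x , λ y → ¬-not (λ eq → ¬hit (y , eq)))

labelled : {A : Set} (N : ℕ) → (Fin N → A) →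
           (r : A → A → Bool) → (∀ a b → r a b ≡ r b a) → Graph
labelled N ℓ r r-sym = record
  { n       = N
  ; adj     = λ u v → not (does (u ≟F v)) ∧ r (ℓ u) (ℓ v)
  ; adj-sym = λ u v → cong₂ (λ d b → not d ∧ b) (does-≟-sym u v) (r-sym (ℓ u) (ℓ v))
  ; adj-irr = λ u → cong (λ d → not d ∧ r (ℓ u) (ℓ u)) (dec-true (u ≟F u) refl)
  }

adj-labelled : ∀ {A : Set} {N} (ℓ : Fin N → A) r r-sym {u v} → u ≢ v →
               adj (labelled N ℓ r r-sym) u v ≡ r (ℓ u) (ℓ v)
adj-labelled _ _ _ {u} {v} u≢v rewrite dec-false (u ≟F v) u≢v = refl

uniform : ℕ → Bool → Graph
uniform N b = labelled N (const tt) (λ _ _ → b) (λ _ _ → refl)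

adj-uniform : ∀ N b {u v} → u ≢ v → adj (uniform N b) u v ≡ b
adj-uniform N b = adj-labelled (const tt) (λ _ _ → b) (λ _ _ → refl)

⊕-adj-outside : ∀ G S {u v} → S u ≡ false → adj (G ⊕ S) u v ≡ adj G u v
⊕-adj-outside G S {u} {v} Su rewrite Su = xor-identityʳ (adj G u v)

⊕-adj-inside : ∀ G S {u v} → S u ≡ true → S v ≡ true → u ≢ v →
               adj (G ⊕ S) u v ≡ not (adj G u v)
⊕-adj-inside G S {u} {v} Su Sv u≢v rewrite Su | Sv | dec-false (u ≟F v) u≢v =
  xor-comm (adj G u v) true

hasInduced-off-diagonal : ∀ G H (ι : Fin (n H) → Fin (n G)) → Injective _≡_ _≡_ ι →
                          (∀ {u v} → u ≢ v → adj H u v ≡ adj G (ι u) (ι v)) →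
                          HasInduced G H
hasInduced-off-diagonal G H ι ι-inj preserves = ι , ι-inj , preserves′
  where
  preserves′ : ∀ u v → adj H u v ≡ adj G (ι u) (ι v)
  preserves′ u v with u ≟F v
  ... | yes refl = trans (adj-irr H u) (sym (adj-irr G (ι u)))
  ... | no u≢v   = preserves u≢v

hasInduced-of-<2 : ∀ G H → n H < 2 → Fin (n G) → HasInduced G H
hasInduced-of-<2 G H small w = hasInduced-off-diagonal G H (const w)
  (λ {u} {v} _ → Fin-subsingleton small u v)
  (λ {u} {v} u≢v → ⊥-elim (u≢v (Fin-subsingleton small u v)))

¬Π-of-<2 : ∀ H G → n H < 2 → Fin (n G) → ¬ Π H G
¬Π-of-<2 H G small w (S , H-free) = H-free (hasInduced-of-<2 (G ⊕ S) H small w)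

Π-uniform : ∀ H {u v : Fin (n H)} N → u ≢ v → Π H (uniform N (not (adj H u v)))
Π-uniform H {u} {v} N u≢v = const false , λ (ι , ι-inj , preserves) → not-¬ refl (begin
  adj H u v                                   ≡⟨ preserves u v ⟩
  adj (uniform N b ⊕ const false) (ι u) (ι v) ≡⟨ ⊕-adj-outside (uniform N b) (const false) {ι u} {ι v} refl ⟩
  adj (uniform N b) (ι u) (ι v)               ≡⟨ adj-uniform N b (u≢v ∘ ι-inj) ⟩
  not (adj H u v)                             ∎)
  where
  b : Bool
  b = not (adj H u v)

¬Π-of-blowUp-embedding :
  ∀ {H G} (e : Fin (n H) × Fin (n H) → Fin (n G)) → Injective _≡_ _≡_ e →
  (∀ x {y y′} → y ≢ y′ → adj G (e (x , y)) (e (x , y′)) ≡ not (adj H y y′)) →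
  (∀ {x x′} y y′ → x ≢ x′ → adj G (e (x , y)) (e (x′ , y′)) ≡ adj H x x′) →
  ¬ Π H G
¬Π-of-blowUp-embedding {H} {G} e e-inj within across (S , H-free)
  with ∀∃false⊎∃∀true (λ x y → S (e (x , y)))
... | inj₁ transversal =
  H-free (hasInduced-off-diagonal (G ⊕ S) H ι (λ eq → cong proj₁ (e-inj eq)) preserves)
  where
  ι : Fin (n H) → Fin (n G)
  ι x = e (x , proj₁ (transversal x))

  preserves : ∀ {u v} → u ≢ v → adj H u v ≡ adj (G ⊕ S) (ι u) (ι v)
  preserves {u} {v} u≢v = begin
    adj H u v                ≡⟨ across _ _ u≢v ⟨
    adj G (ι u) (ι v)        ≡⟨ ⊕-adj-outside G S {ι u} {ι v} (proj₂ (transversal u)) ⟨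
    adj (G ⊕ S) (ι u) (ι v)  ∎
... | inj₂ (x₀ , row⊆S) = H-free (hasInduced-off-diagonal (G ⊕ S) H ι ι-inj preserves)
  where
  ι : Fin (n H) → Fin (n G)
  ι y = e (x₀ , y)

  ι-inj : Injective _≡_ _≡_ ι
  ι-inj eq = cong proj₂ (e-inj eq)

  preserves : ∀ {u v} → u ≢ v → adj H u v ≡ adj (G ⊕ S) (ι u) (ι v)
  preserves {u} {v} u≢v = begin
    adj H u v                ≡⟨ not-involutive _ ⟨
    not (not (adj H u v))    ≡⟨ cong not (within x₀ u≢v) ⟨
    not (adj G (ι u) (ι v))  ≡⟨ ⊕-adj-inside G S (row⊆S u) (row⊆S v) (u≢v ∘ ι-inj) ⟨
    adj (G ⊕ S) (ι u) (ι v)  ∎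

-- just (x , y) is vertex y of the copy of the complement of H indexed by x;
-- nothing labels an isolated padding vertex.
blowUpRel : (H : Graph) → (_ _ : Maybe (Fin (n H) × Fin (n H))) → Bool
blowUpRel H (just (x , y)) (just (x′ , y′)) =
  if does (x ≟F x′) then not (adj H y y′) else adj H x x′
blowUpRel H (just _)       nothing          = false
blowUpRel H nothing        _                = false

blowUpRel-within : ∀ H x y y′ → blowUpRel H (just (x , y)) (just (x , y′)) ≡ not (adj H y y′)
blowUpRel-within H x y y′ rewrite dec-true (x ≟F x) refl = refl

blowUpRel-across : ∀ H {x x′} y y′ → x ≢ x′ →
                   blowUpRel H (just (x , y)) (just (x′ , y′)) ≡ adj H x x′
blowUpRel-across H {x} {x′} y y′ x≢x′ rewrite dec-false (x ≟F x′) x≢x′ = refl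

blowUpRel-sym : ∀ H p q → blowUpRel H p q ≡ blowUpRel H q p
blowUpRel-sym H (just (x , y)) (just (x′ , y′)) with x ≟F x′
... | yes refl = trans (cong not (adj-sym H y y′)) (sym (blowUpRel-within H x y′ y))
... | no x≢x′  = trans (adj-sym H x x′) (sym (blowUpRel-across H y′ y (x≢x′ ∘ sym)))
blowUpRel-sym H (just _) nothing  = refl
blowUpRel-sym H nothing  (just _) = refl
blowUpRel-sym H nothing  nothing  = refl

blowUpLabel : ∀ H m → Fin (n H * n H + m) → Maybe (Fin (n H) × Fin (n H))
blowUpLabel H m = [ just ∘ remQuot (n H) , const nothing ]′ ∘ splitAt (n H * n H)

blowUp : Graph → ℕ → Graph
blowUp H m = labelled (n H * n H + m) (blowUpLabel H m) (blowUpRel H) (blowUpRel-sym H)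

blowUpVertex : ∀ H m → Fin (n H) × Fin (n H) → Fin (n (blowUp H m))
blowUpVertex H m (x , y) = combine x y ↑ˡ m

blowUpLabel-vertex : ∀ H m p → blowUpLabel H m (blowUpVertex H m p) ≡ just p
blowUpLabel-vertex H m (x , y)
  rewrite splitAt-↑ˡ (n H * n H) (combine x y) m | remQuot-combine {n H} {n H} x y = refl

blowUpVertex-injective : ∀ H m → Injective _≡_ _≡_ (blowUpVertex H m)
blowUpVertex-injective H m {p} {q} eq = just-injective (begin
  just p                              ≡⟨ blowUpLabel-vertex H m p ⟨
  blowUpLabel H m (blowUpVertex H m p) ≡⟨ cong (blowUpLabel H m) eq ⟩
  blowUpLabel H m (blowUpVertex H m q) ≡⟨ blowUpLabel-vertex H m q ⟩
  just q                              ∎)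

adj-blowUpVertex : ∀ H m {p q} → p ≢ q →
                   adj (blowUp H m) (blowUpVertex H m p) (blowUpVertex H m q) ≡
                   blowUpRel H (just p) (just q)
adj-blowUpVertex H m {p} {q} p≢q = begin
  adj (blowUp H m) (blowUpVertex H m p) (blowUpVertex H m q)
    ≡⟨ adj-labelled (blowUpLabel H m) (blowUpRel H) (blowUpRel-sym H) (p≢q ∘ blowUpVertex-injective H m) ⟩
  blowUpRel H (blowUpLabel H m (blowUpVertex H m p)) (blowUpLabel H m (blowUpVertex H m q))
    ≡⟨ cong₂ (blowUpRel H) (blowUpLabel-vertex H m p) (blowUpLabel-vertex H m q) ⟩
  blowUpRel H (just p) (just q)
    ∎

¬Π-blowUp : ∀ H m → ¬ Π H (blowUp H m)
¬Π-blowUp H m =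
  ¬Π-of-blowUp-embedding {H} {blowUp H m} (blowUpVertex H m) (blowUpVertex-injective H m)
    (λ x {y} {y′} y≢y′ →
      trans (adj-blowUpVertex H m (y≢y′ ∘ cong proj₂)) (blowUpRel-within H x y y′))
    (λ y y′ x≢x′ →
      trans (adj-blowUpVertex H m (x≢x′ ∘ cong proj₁)) (blowUpRel-across H y y′ x≢x′))

≅⇒≥ : ∀ {G G′} → G ≅ G′ → n G′ ≤ n G
≅⇒≥ (f , _) = injective⇒≤ (Injection.injective (↔⇒↣ (↔-sym f)))

≅-of-no-vertices : ∀ {G G′} → ¬ Fin (n G) → ¬ Fin (n G′) → G ≅ G′
≅-of-no-vertices ¬v ¬v′ =
  mk↔ₛ′ (⊥-elim ∘ ¬v) (⊥-elim ∘ ¬v′) (⊥-elim ∘ ¬v′) (⊥-elim ∘ ¬v) , λ u → ⊥-elim (¬v u)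

infinitelyMany-of-unbounded : {P : Graph → Set} → (∀ N → ∃ λ G → P G × N ≤ n G) →
                              InfinitelyMany P
infinitelyMany-of-unbounded unbounded L with unbounded (suc (max 0 (map n L)))
... | G , PG , large = G , PG , All.map
  (λ {G′} G′≤max G′≅G → <⇒≱ (≤-<-trans G′≤max large) (≅⇒≥ {G′} {G} G′≅G))
  (map⁻ (xs≤max 0 (map n L)))

lemma1 : (H : Graph) → Nontrivial (Π H) ⇔ (2 ≤ n H)
lemma1 H = mk⇔ nontrivial⇒2≤ 2≤⇒nontrivial
  where
  nontrivial⇒2≤ : Nontrivial (Π H) → 2 ≤ n H
  nontrivial⇒2≤ (manyΠ , _) with manyΠ (uniform 0 false ∷ [])
  ... | G , ΠG , G≇∅ ∷ [] =
    ≮⇒≥ λ small → G≇∅ (≅-of-no-vertices {uniform 0 false} {G} (λ ()) (λ w → ¬Π-of-<2 H G small w ΠG))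

  2≤⇒nontrivial : 2 ≤ n H → Nontrivial (Π H)
  2≤⇒nontrivial two with distinct-of-2≤ two
  ... | u , v , u≢v =
    infinitelyMany-of-unbounded
      (λ N → uniform N (not (adj H u v)) , Π-uniform H N u≢v , ≤-refl) ,
    infinitelyMany-of-unbounded
      (λ N → blowUp H N , ¬Π-blowUp H N , m≤n+m N (n H * n H))
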